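{- Let $g_d$ be the NAND tree function of depth $d$ and $\alpha=\frac{1+\sqrt{33}}{4}$. There exists a constant $\delta>0$ such that $\mathsf{D}^{\mathsf{prod}}(g_d)=O((\alpha-\delta)^d)$.
   Context: The NAND tree function $g_d:\{0,1\}^{2^d}\to\{0,1\}$ is the Boolean formula given by a complete binary tree of depth $d$ whose $2^d$ leaves are labelled by distinct variables and whose internal nodes are binary NAND gates. For a distribution $\mu$ on inputs, $\mathsf{D}^\mu_{1/3}(g)$ is the minimum depth of a deterministic decision tree $T$ with $\Pr_{x\sim\mu}[T(x)\neq g(x)]\le1/3$; $\mathsf{D}^{\mathsf{prod}}(g)$ is the maximum of $\mathsf{D}^\mu_{1/3}(g)$ over all product distributions $\mu$ (distributions under which the input bits are independent).
   Formalization: The maximum in $\mathsf{D}^{\mathsf{prod}}(g)$ is taken only over product distributions μ under which each input bit equals 1 with a rational probability. -}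

module Defs where

open import Data.Bool using (Bool; true; false; not; _∧_; if_then_else_)
open import Data.Nat as ℕ using (ℕ; zero; suc; _⊔_)
open import Data.Fin using (Fin)
open import Data.Vec using (Vec; []; _∷_; take; drop; lookup)
open import Data.List using (List; []; _∷_; map; _++_; foldr)
open import Data.Integer using (+_)
open import Data.Rational using (ℚ; _+_; _*_; _-_; _<_; _≤_; 0ℚ; 1ℚ; _/_)
open import Data.Product using (Σ; _×_; ∃)
open import Data.Sum using (_⊎_)
open import Relation.Binary.PropositionalEquality using (_≡_)

nand : Bool → Bool → Bool
nand a b = not (a ∧ b)

nandTree : (d : ℕ) → Vec Bool (2 ℕ.^ d) → Bool
nandTree zero    (x ∷ []) = x
nandTree (suc d) xs =
  nand (nandTree d (take (2 ℕ.^ d) xs))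
       (nandTree d (take (2 ℕ.^ d) (drop (2 ℕ.^ d) xs)))

data DTree (n : ℕ) : Set where
  leaf  : Bool → DTree n
  query : Fin n → DTree n → DTree n → DTree n

depth : ∀ {n} → DTree n → ℕ
depth (leaf _)        = 0
depth (query _ t₀ t₁) = suc (depth t₀ ⊔ depth t₁)

run : ∀ {n} → DTree n → Vec Bool n → Bool
run (leaf b)        x = b
run (query i t₀ t₁) x = if lookup x i then run t₁ x else run t₀ x

allInputs : (n : ℕ) → List (Vec Bool n)
allInputs zero    = [] ∷ []
allInputs (suc n) = map (false ∷_) (allInputs n) ++ map (true ∷_) (allInputs n)

-- A product distribution on {0,1}^n is given by the marginals
-- p i = Pr[x_i = 1] ∈ [0,1] (rational).
IsProductDist : ∀ {n} → (Fin n → ℚ) → Set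
IsProductDist {n} p = (i : Fin n) → (0ℚ ≤ p i) × (p i ≤ 1ℚ)

prob : ∀ {n} → (Fin n → ℚ) → Vec Bool n → ℚ
prob p x = go x p
  where
  go : ∀ {m} → Vec Bool m → (Fin m → ℚ) → ℚ
  go []       q = 1ℚ
  go (b ∷ xs) q = (if b then q Fin.zero else 1ℚ - q Fin.zero) * go xs (λ i → q (Fin.suc i))

errorProb : ∀ {n} → (Fin n → ℚ) → DTree n → (Vec Bool n → Bool) → ℚ
errorProb {n} p T f =
  foldr (λ x acc → (if eqB (run T x) (f x) then 0ℚ else prob p x) + acc) 0ℚ (allInputs n)
  where
  eqB : Bool → Bool → Bool
  eqB true  true  = true
  eqB false false = true
  eqB _     _     = false

-- D^μ_{1/3}(f) ≤ k : some decision tree of depth ≤ k errs w.p. ≤ 1/3 under μ.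
-- Since D^prod is a maximum over product μ, D^prod(f) ≤ k iff this holds for all product μ.
DprodAtMost : ∀ {n} → (Vec Bool n → Bool) → ℚ → Set
DprodAtMost {n} f k =
  (p : Fin n → ℚ) → IsProductDist p →
  Σ (DTree n) λ T → ((+ depth T / 1) ≤ k) × (errorProb p T f ≤ + 1 / 3)

-- β < α = (1 + √33)/4, decided in ℚ: 4β - 1 < 0 or (4β - 1)² < 33.
LtAlpha : ℚ → Set
LtAlpha β = (u < 0ℚ) ⊎ (u * u < + 33 / 1)
  where u = (+ 4 / 1) * β - 1ℚ

powℚ : ℚ → ℕ → ℚ
powℚ b zero    = 1ℚ
powℚ b (suc d) = b * powℚ b d

{-# OPTIONS --safe #-}

-- Evaluate g_(d+1) by evaluating first the subtree that is less likely to output 1, and the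
-- other one only if the first outputs 1. The subtrees read disjoint variables, so under a
-- product distribution they are independent and the expected number of queries is
-- C_first + q_first · C_second, where q = Pr[g_d = 1]. Induction on d bounds it by
-- (4 − q) · (5/3)^d, and 5/3 < α. By Markov's inequality, cutting this zero-error tree at
-- depth 12 · (5/3)^d errs with probability at most 1/3.
module Submission where

open import Defs
open import Data.Nat using (ℕ; _≥_)
open import Data.Rational using (ℚ; _*_; _<_; 0ℚ)
open import Data.Product using (Σ; _×_)

open import Function using (_∘_)
open import Data.Bool using (Bool; true; false; not; if_then_else_; _xor_)
import Data.Nat as ℕ
import Data.Nat.Properties as ℕₚ
open import Data.Nat using (zero; suc)
open import Data.Fin using (Fin; zero; suc; _↑ˡ_; _↑ʳ_)
open import Data.Vec using (Vec; []; _∷_; take; drop; lookup)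
open import Data.Vec.Properties using (take++drop≡id; lookup-++ˡ; lookup-++ʳ)
open import Data.Vec.Functional using (tail)
open import Data.List using (List; foldr)
import Data.List as List
open import Data.List.Properties using (foldr-cong; foldr-map)
open import Data.Integer using (+_)
import Data.Integer as ℤ
import Data.Integer.Properties as ℤₚ
import Data.Nat.Coprimality as Coprimality
open import Data.Rational using (_+_; _-_; -_; _≤_; 1ℚ; _/_; _≤?_; _<?_; mkℚ; *≤*)
open import Data.Rational using (nonNegative; nonPositive; positive)
open import Data.Rational.Properties
open import Data.Rational.Solver using (module +-*-Solver)
open import Data.Product using (_,_; proj₁; proj₂)
open import Data.Sum using (inj₁; inj₂)
open import Data.Empty using (⊥-elim)
open import Relation.Nullary using (yes; no)
open import Relation.Nullary.Decidable using (True; toWitness)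
open import Relation.Binary.PropositionalEquality

open +-*-Solver using (solve; _:=_; con; _:+_; _:-_; _:*_)

decide-≤ : (p q : ℚ) → {True (p ≤? q)} → p ≤ q
decide-≤ p q {p≤q} = toWitness p≤q

decide-< : (p q : ℚ) → {True (p <? q)} → p < q
decide-< p q {p<q} = toWitness p<q

*-nonNeg : ∀ {p q} → 0ℚ ≤ p → 0ℚ ≤ q → 0ℚ ≤ p * q
*-nonNeg {p} {q} 0≤p 0≤q =
  subst (_≤ p * q) (*-zeroʳ p) (*-monoˡ-≤-nonNeg p {{nonNegative 0≤p}} 0≤q)

square-nonNeg : ∀ p → 0ℚ ≤ p * p
square-nonNeg p with ≤-total 0ℚ p
... | inj₁ 0≤p = *-nonNeg 0≤p 0≤p
... | inj₂ p≤0 = subst (_≤ p * p) (*-zeroʳ p) (*-monoˡ-≤-nonPos p {{nonPositive p≤0}} p≤0)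

p≤q⇒0≤q-p : ∀ {p q} → p ≤ q → 0ℚ ≤ q - p
p≤q⇒0≤q-p {p} {q} p≤q = subst (_≤ q - p) (+-inverseʳ p) (+-monoˡ-≤ (- p) p≤q)

0≤q-p⇒p≤q : ∀ {p q} → 0ℚ ≤ q - p → p ≤ q
0≤q-p⇒p≤q {p} {q} 0≤q-p = subst₂ _≤_ (+-identityʳ p) p+[q-p]≡q (+-monoʳ-≤ p 0≤q-p)
  where
  p+[q-p]≡q : p + (q - p) ≡ q
  p+[q-p]≡q = solve 2 (λ p q → p :+ (q :- p) := q) refl p q

toℚ : ℕ → ℚ
toℚ n = + n / 1

coprimeTo-1 : ∀ n → Coprimality.Coprime n 1
coprimeTo-1 n = Coprimality.sym (Coprimality.1-coprimeTo n)

toℚ≡mkℚ : ∀ n → toℚ n ≡ mkℚ (+ n) 0 (coprimeTo-1 n)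
toℚ≡mkℚ n = normalize-coprime (coprimeTo-1 n)

toℚ-suc : ∀ n → toℚ (suc n) ≡ 1ℚ + toℚ n
toℚ-suc n = begin
  (+ 1 ℤ.+ + n) / 1                ≡⟨ cong (λ m → (+ 1 ℤ.+ m) / 1) (sym (ℤₚ.*-identityʳ (+ n))) ⟩
  (+ 1 ℤ.+ + n ℤ.* + 1) / 1        ≡⟨⟩
  1ℚ + mkℚ (+ n) 0 (coprimeTo-1 n) ≡⟨ cong (_+_ 1ℚ) (sym (toℚ≡mkℚ n)) ⟩
  1ℚ + toℚ n                       ∎
  where open ≡-Reasoning

toℚ-mono-≤ : ∀ {m n} → m ℕ.≤ n → toℚ m ≤ toℚ n
toℚ-mono-≤ {m} {n} m≤n = subst₂ _≤_ (sym (toℚ≡mkℚ m)) (sym (toℚ≡mkℚ n))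
  (*≤* (subst₂ ℤ._≤_ (sym (ℤₚ.*-identityʳ (+ m))) (sym (ℤₚ.*-identityʳ (+ n))) (ℤ.+≤+ m≤n)))

≤-numerator : ∀ p → 0ℚ ≤ p → Σ ℕ λ n → p ≤ toℚ n
≤-numerator p@(mkℚ (+ n) _ _) _ = n , subst (p ≤_) (sym (toℚ≡mkℚ n))
  (*≤* (ℤₚ.*-monoˡ-≤-nonNeg (+ n) (ℤ.+≤+ (ℕ.s≤s ℕ.z≤n))))
≤-numerator (mkℚ ℤ.-[1+ _ ] _ _) (*≤* ())

ℕ-floor : ∀ p → 0ℚ ≤ p → Σ ℕ λ k → toℚ k ≤ p × p ≤ toℚ (suc k)
ℕ-floor p 0≤p with ≤-numerator p 0≤p
... | n , p≤n = descend n p≤n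
  where
  descend : ∀ n → p ≤ toℚ n → Σ ℕ λ k → toℚ k ≤ p × p ≤ toℚ (suc k)
  descend zero    p≤0   = 0 , 0≤p , ≤-trans p≤0 (toℚ-mono-≤ {0} {1} ℕ.z≤n)
  descend (suc n) p≤n+1 with toℚ n ≤? p
  ... | yes n≤p = n , n≤p , p≤n+1
  ... | no  n≰p = descend n (<⇒≤ (≰⇒> n≰p))

mix : ℚ → ℚ → ℚ → ℚ
mix u a b = (1ℚ - u) * a + u * b

mix-const : ∀ u c → mix u c c ≡ c
mix-const = solve 2 (λ u c → (con 1ℚ :- u) :* c :+ u :* c := c) refl

mix-+ : ∀ u a b a′ b′ → mix u (a + a′) (b + b′) ≡ mix u a b + mix u a′ b′
mix-+ = solve 5 (λ u a b a′ b′ → (con 1ℚ :- u) :* (a :+ a′) :+ u :* (b :+ b′)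
                 := ((con 1ℚ :- u) :* a :+ u :* b) :+ ((con 1ℚ :- u) :* a′ :+ u :* b′)) refl

mix-*ˡ : ∀ u c a b → mix u (c * a) (c * b) ≡ c * mix u a b
mix-*ˡ = solve 4 (λ u c a b → (con 1ℚ :- u) :* (c :* a) :+ u :* (c :* b)
                  := c :* ((con 1ℚ :- u) :* a :+ u :* b)) refl

mix-*ʳ : ∀ u c a b → mix u (a * c) (b * c) ≡ mix u a b * c
mix-*ʳ = solve 4 (λ u c a b → (con 1ℚ :- u) :* (a :* c) :+ u :* (b :* c)
                  := ((con 1ℚ :- u) :* a :+ u :* b) :* c) refl

mix-const- : ∀ u c a b → mix u (c - a) (c - b) ≡ c - mix u a b
mix-const- = solve 4 (λ u c a b → (con 1ℚ :- u) :* (c :- a) :+ u :* (c :- b)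
                      := c :- ((con 1ℚ :- u) :* a :+ u :* b)) refl

mix-mono-≤ : ∀ {u a b a′ b′} → 0ℚ ≤ u → u ≤ 1ℚ → a ≤ a′ → b ≤ b′ → mix u a b ≤ mix u a′ b′
mix-mono-≤ {u} 0≤u u≤1 a≤a′ b≤b′ = +-mono-≤
  (*-monoˡ-≤-nonNeg (1ℚ - u) {{nonNegative (p≤q⇒0≤q-p u≤1)}} a≤a′)
  (*-monoˡ-≤-nonNeg u {{nonNegative 0≤u}} b≤b′)

𝔼 : ∀ {n} → (Fin n → ℚ) → (Vec Bool n → ℚ) → ℚ
𝔼 {zero}  p h = h []
𝔼 {suc n} p h = mix (p zero) (𝔼 (tail p) (h ∘ (false ∷_))) (𝔼 (tail p) (h ∘ (true ∷_)))

𝔼-cong : ∀ {n} (p : Fin n → ℚ) {h k : Vec Bool n → ℚ} → (∀ x → h x ≡ k x) → 𝔼 p h ≡ 𝔼 p k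
𝔼-cong {zero}  p h≗k = h≗k []
𝔼-cong {suc n} p h≗k =
  cong₂ (mix (p zero)) (𝔼-cong (tail p) (h≗k ∘ (false ∷_))) (𝔼-cong (tail p) (h≗k ∘ (true ∷_)))

𝔼-const : ∀ {n} (p : Fin n → ℚ) c → 𝔼 p (λ _ → c) ≡ c
𝔼-const {zero}  p c = refl
𝔼-const {suc n} p c =
  trans (cong₂ (mix (p zero)) (𝔼-const (tail p) c) (𝔼-const (tail p) c)) (mix-const (p zero) c)

𝔼-+ : ∀ {n} (p : Fin n → ℚ) (h k : Vec Bool n → ℚ) → 𝔼 p (λ x → h x + k x) ≡ 𝔼 p h + 𝔼 p k
𝔼-+ {zero}  p h k = refl
𝔼-+ {suc n} p h k =
  trans (cong₂ (mix (p zero)) (𝔼-+ (tail p) (h ∘ (false ∷_)) (k ∘ (false ∷_)))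
                              (𝔼-+ (tail p) (h ∘ (true ∷_)) (k ∘ (true ∷_))))
        (mix-+ (p zero) _ _ _ _)

𝔼-*ˡ : ∀ {n} (p : Fin n → ℚ) c (h : Vec Bool n → ℚ) → 𝔼 p (λ x → c * h x) ≡ c * 𝔼 p h
𝔼-*ˡ {zero}  p c h = refl
𝔼-*ˡ {suc n} p c h =
  trans (cong₂ (mix (p zero)) (𝔼-*ˡ (tail p) c (h ∘ (false ∷_))) (𝔼-*ˡ (tail p) c (h ∘ (true ∷_))))
        (mix-*ˡ (p zero) c _ _)

𝔼-const- : ∀ {n} (p : Fin n → ℚ) c (h : Vec Bool n → ℚ) → 𝔼 p (λ x → c - h x) ≡ c - 𝔼 p h
𝔼-const- {zero}  p c h = refl
𝔼-const- {suc n} p c h =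
  trans (cong₂ (mix (p zero)) (𝔼-const- (tail p) c (h ∘ (false ∷_)))
                              (𝔼-const- (tail p) c (h ∘ (true ∷_))))
        (mix-const- (p zero) c _ _)

𝔼-mono-≤ : ∀ {n} {p : Fin n → ℚ} → IsProductDist p →
           {h k : Vec Bool n → ℚ} → (∀ x → h x ≤ k x) → 𝔼 p h ≤ 𝔼 p k
𝔼-mono-≤ {zero}  p-dist h≤k = h≤k []
𝔼-mono-≤ {suc n} p-dist h≤k = mix-mono-≤ (proj₁ (p-dist zero)) (proj₂ (p-dist zero))
  (𝔼-mono-≤ (p-dist ∘ suc) (h≤k ∘ (false ∷_)))
  (𝔼-mono-≤ (p-dist ∘ suc) (h≤k ∘ (true ∷_)))

𝔼-nonNeg : ∀ {n} {p : Fin n → ℚ} → IsProductDist p → {h : Vec Bool n → ℚ} → (∀ x → 0ℚ ≤ h x) → 0ℚ ≤ 𝔼 p h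
𝔼-nonNeg {p = p} p-dist {h} 0≤h = subst (_≤ 𝔼 p h) (𝔼-const p 0ℚ) (𝔼-mono-≤ p-dist 0≤h)

𝔼-take*drop : ∀ m {k} (p : Fin (m ℕ.+ k) → ℚ) (h : Vec Bool m → ℚ) (g : Vec Bool k → ℚ) →
              𝔼 p (λ x → h (take m x) * g (drop m x)) ≡ 𝔼 (p ∘ (_↑ˡ k)) h * 𝔼 (p ∘ (m ↑ʳ_)) g
𝔼-take*drop zero    p h g = 𝔼-*ˡ p (h []) g
𝔼-take*drop (suc m) p h g =
  trans (cong₂ (mix (p zero)) (𝔼-take*drop m (tail p) (h ∘ (false ∷_)) g)
                              (𝔼-take*drop m (tail p) (h ∘ (true ∷_)) g))
        (mix-*ʳ (p zero) _ _ _)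

𝔼-take : ∀ m {k} (p : Fin (m ℕ.+ k) → ℚ) (h : Vec Bool m → ℚ) →
         𝔼 p (h ∘ take m) ≡ 𝔼 (p ∘ (_↑ˡ k)) h
𝔼-take m {k} p h = begin
  𝔼 p (h ∘ take m)                                     ≡⟨ 𝔼-cong p (λ x → sym (*-identityʳ (h (take m x)))) ⟩
  𝔼 p (λ x → h (take m x) * 1ℚ)                        ≡⟨ 𝔼-take*drop m p h (λ _ → 1ℚ) ⟩
  𝔼 (p ∘ (_↑ˡ k)) h * 𝔼 (p ∘ (m ↑ʳ_)) (λ _ → 1ℚ)      ≡⟨ cong (𝔼 (p ∘ (_↑ˡ k)) h *_) (𝔼-const (p ∘ (m ↑ʳ_)) 1ℚ) ⟩
  𝔼 (p ∘ (_↑ˡ k)) h * 1ℚ                               ≡⟨ *-identityʳ _ ⟩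
  𝔼 (p ∘ (_↑ˡ k)) h                                    ∎
  where open ≡-Reasoning

𝔼-drop : ∀ m {k} (p : Fin (m ℕ.+ k) → ℚ) (g : Vec Bool k → ℚ) →
         𝔼 p (g ∘ drop m) ≡ 𝔼 (p ∘ (m ↑ʳ_)) g
𝔼-drop m {k} p g = begin
  𝔼 p (g ∘ drop m)                                     ≡⟨ 𝔼-cong p (λ x → sym (*-identityˡ (g (drop m x)))) ⟩
  𝔼 p (λ x → 1ℚ * g (drop m x))                        ≡⟨ 𝔼-take*drop m p (λ _ → 1ℚ) g ⟩
  𝔼 (p ∘ (_↑ˡ k)) (λ _ → 1ℚ) * 𝔼 (p ∘ (m ↑ʳ_)) g      ≡⟨ cong (_* 𝔼 (p ∘ (m ↑ʳ_)) g) (𝔼-const (p ∘ (_↑ˡ k)) 1ℚ) ⟩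
  1ℚ * 𝔼 (p ∘ (m ↑ʳ_)) g                               ≡⟨ *-identityˡ _ ⟩
  𝔼 (p ∘ (m ↑ʳ_)) g                                    ∎
  where open ≡-Reasoning

𝟙 : Bool → ℚ
𝟙 b = if b then 1ℚ else 0ℚ

𝟙-nonNeg : ∀ b → 0ℚ ≤ 𝟙 b
𝟙-nonNeg true  = decide-≤ 0ℚ 1ℚ
𝟙-nonNeg false = ≤-refl

𝟙-≤-1 : ∀ b → 𝟙 b ≤ 1ℚ
𝟙-≤-1 true  = ≤-refl
𝟙-≤-1 false = decide-≤ 0ℚ 1ℚ

𝟙-nand : ∀ a b → 𝟙 (nand a b) ≡ 1ℚ - 𝟙 a * 𝟙 b
𝟙-nand true  true  = refl
𝟙-nand true  false = refl
𝟙-nand false true  = refl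
𝟙-nand false false = refl

sumBy : {A : Set} → (A → ℚ) → List A → ℚ
sumBy h = foldr (λ x acc → h x + acc) 0ℚ

sumBy-++ : {A : Set} (h : A → ℚ) (xs ys : List A) → sumBy h (xs List.++ ys) ≡ sumBy h xs + sumBy h ys
sumBy-++ h List.[]         ys = sym (+-identityˡ _)
sumBy-++ h (x List.∷ xs) ys = trans (cong (_+_ (h x)) (sumBy-++ h xs ys)) (sym (+-assoc (h x) _ _))

sumBy-*ˡ : {A : Set} (c : ℚ) (h : A → ℚ) (xs : List A) → sumBy (λ x → c * h x) xs ≡ c * sumBy h xs
sumBy-*ˡ c h List.[]         = sym (*-zeroʳ c)
sumBy-*ˡ c h (x List.∷ xs) = trans (cong (_+_ (c * h x)) (sumBy-*ˡ c h xs)) (sym (*-distribˡ-+ c (h x) _))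

sumBy-prob≡𝔼 : ∀ {n} (p : Fin n → ℚ) (h : Vec Bool n → ℚ) →
               sumBy (λ x → prob p x * h x) (allInputs n) ≡ 𝔼 p h
sumBy-prob≡𝔼 {zero}  p h = trans (+-identityʳ _) (*-identityˡ _)
sumBy-prob≡𝔼 {suc n} p h = begin
  sumBy w (List.map (false ∷_) xs List.++ List.map (true ∷_) xs)
    ≡⟨ sumBy-++ w (List.map (false ∷_) xs) (List.map (true ∷_) xs) ⟩
  sumBy w (List.map (false ∷_) xs) + sumBy w (List.map (true ∷_) xs)
    ≡⟨ cong₂ _+_ (foldr-map _ (false ∷_) 0ℚ xs) (foldr-map _ (true ∷_) 0ℚ xs) ⟩
  sumBy (w ∘ (false ∷_)) xs + sumBy (w ∘ (true ∷_)) xs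
    ≡⟨ cong₂ _+_ (half false (1ℚ - p zero)) (half true (p zero)) ⟩
  mix (p zero) (𝔼 (tail p) (h ∘ (false ∷_))) (𝔼 (tail p) (h ∘ (true ∷_)))
    ∎
  where
  open ≡-Reasoning
  xs = allInputs n
  w : Vec Bool (suc n) → ℚ
  w x = prob p x * h x
  half : ∀ b c → sumBy (λ x → (c * prob (tail p) x) * h (b ∷ x)) xs ≡ c * 𝔼 (tail p) (h ∘ (b ∷_))
  half b c = begin
    sumBy (λ x → (c * prob (tail p) x) * h (b ∷ x)) xs
      ≡⟨ foldr-cong (λ x acc → cong (_+ acc) (*-assoc c (prob (tail p) x) (h (b ∷ x)))) refl xs ⟩
    sumBy (λ x → c * (prob (tail p) x * h (b ∷ x))) xs
      ≡⟨ sumBy-*ˡ c _ xs ⟩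
    c * sumBy (λ x → prob (tail p) x * h (b ∷ x)) xs
      ≡⟨ cong (c *_) (sumBy-prob≡𝔼 (tail p) (h ∘ (b ∷_))) ⟩
    c * 𝔼 (tail p) (h ∘ (b ∷_))
      ∎

-- The fold step of errorProb uses a where-bound equality test that cannot be named here;
-- unification extracts it.
errorProb-step : ∀ {n} (p : Fin n → ℚ) (T : DTree n) (f : Vec Bool n → Bool) →
                 Σ (Vec Bool n → ℚ → ℚ) λ step → errorProb p T f ≡ foldr step 0ℚ (allInputs n)
errorProb-step p T f = _ , refl

errorProb-step-≡ : ∀ {n} (p : Fin n → ℚ) (T : DTree n) f x acc →
                   proj₁ (errorProb-step p T f) x acc ≡ prob p x * 𝟙 (run T x xor f x) + acc
errorProb-step-≡ p T f x acc with run T x | f x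
... | true  | true  = cong (_+ acc) (sym (*-zeroʳ (prob p x)))
... | true  | false = cong (_+ acc) (sym (*-identityʳ (prob p x)))
... | false | true  = cong (_+ acc) (sym (*-identityʳ (prob p x)))
... | false | false = cong (_+ acc) (sym (*-zeroʳ (prob p x)))

errorProb≡𝔼 : ∀ {n} (p : Fin n → ℚ) (T : DTree n) f → errorProb p T f ≡ 𝔼 p (λ x → 𝟙 (run T x xor f x))
errorProb≡𝔼 {n} p T f = begin
  errorProb p T f
    ≡⟨ proj₂ (errorProb-step p T f) ⟩
  foldr (proj₁ (errorProb-step p T f)) 0ℚ (allInputs n)
    ≡⟨ foldr-cong (errorProb-step-≡ p T f) refl (allInputs n) ⟩
  sumBy (λ x → prob p x * 𝟙 (run T x xor f x)) (allInputs n)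
    ≡⟨ sumBy-prob≡𝔼 p _ ⟩
  𝔼 p (λ x → 𝟙 (run T x xor f x))
    ∎
  where open ≡-Reasoning

cost : ∀ {n} → DTree n → Vec Bool n → ℚ
cost (leaf _)        x = 0ℚ
cost (query i t₀ t₁) x = 1ℚ + (if lookup x i then cost t₁ x else cost t₀ x)

cost-nonNeg : ∀ {n} (T : DTree n) x → 0ℚ ≤ cost T x
cost-nonNeg (leaf _)        x = ≤-refl
cost-nonNeg (query i t₀ t₁) x with lookup x i
... | true  = +-mono-≤ (decide-≤ 0ℚ 1ℚ) (cost-nonNeg t₁ x)
... | false = +-mono-≤ (decide-≤ 0ℚ 1ℚ) (cost-nonNeg t₀ x)

bind : ∀ {n} → DTree n → (Bool → DTree n) → DTree n
bind (leaf b)        k = k b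
bind (query i t₀ t₁) k = query i (bind t₀ k) (bind t₁ k)

run-bind : ∀ {n} (T : DTree n) k x → run (bind T k) x ≡ run (k (run T x)) x
run-bind (leaf b)        k x = refl
run-bind (query i t₀ t₁) k x with lookup x i
... | true  = run-bind t₁ k x
... | false = run-bind t₀ k x

cost-bind : ∀ {n} (T : DTree n) k x → cost (bind T k) x ≡ cost T x + cost (k (run T x)) x
cost-bind (leaf b)        k x = sym (+-identityˡ _)
cost-bind (query i t₀ t₁) k x with lookup x i
... | true  = trans (cong (_+_ 1ℚ) (cost-bind t₁ k x)) (sym (+-assoc 1ℚ (cost t₁ x) _))
... | false = trans (cong (_+_ 1ℚ) (cost-bind t₀ k x)) (sym (+-assoc 1ℚ (cost t₀ x) _))

negate : ∀ {n} → DTree n → DTree n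
negate (leaf b)        = leaf (not b)
negate (query i t₀ t₁) = query i (negate t₀) (negate t₁)

run-negate : ∀ {n} (T : DTree n) x → run (negate T) x ≡ not (run T x)
run-negate (leaf b)        x = refl
run-negate (query i t₀ t₁) x with lookup x i
... | true  = run-negate t₁ x
... | false = run-negate t₀ x

cost-negate : ∀ {n} (T : DTree n) x → cost (negate T) x ≡ cost T x
cost-negate (leaf b)        x = refl
cost-negate (query i t₀ t₁) x with lookup x i
... | true  = cong (_+_ 1ℚ) (cost-negate t₁ x)
... | false = cong (_+_ 1ℚ) (cost-negate t₀ x)

nandWith : ∀ {n} → Bool → DTree n → DTree n
nandWith false T = leaf true
nandWith true  T = negate T

nandᵀ : ∀ {n} → DTree n → DTree n → DTree n
nandᵀ T₁ T₂ = bind T₁ (λ b → nandWith b T₂)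

run-nandᵀ : ∀ {n} (T₁ T₂ : DTree n) x → run (nandᵀ T₁ T₂) x ≡ nand (run T₁ x) (run T₂ x)
run-nandᵀ T₁ T₂ x with run T₁ x | run-bind T₁ (λ b → nandWith b T₂) x
... | false | eq = eq
... | true  | eq = trans eq (run-negate T₂ x)

cost-nandᵀ : ∀ {n} (T₁ T₂ : DTree n) x → cost (nandᵀ T₁ T₂) x ≡ cost T₁ x + 𝟙 (run T₁ x) * cost T₂ x
cost-nandᵀ T₁ T₂ x with run T₁ x | cost-bind T₁ (λ b → nandWith b T₂) x
... | false | eq = trans eq (cong (_+_ (cost T₁ x)) (sym (*-zeroˡ (cost T₂ x))))
... | true  | eq = trans eq (cong (_+_ (cost T₁ x)) (trans (cost-negate T₂ x) (sym (*-identityˡ (cost T₂ x)))))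

relabel : ∀ {m n} → (Fin m → Fin n) → DTree m → DTree n
relabel σ (leaf b)        = leaf b
relabel σ (query i t₀ t₁) = query (σ i) (relabel σ t₀) (relabel σ t₁)

module _ {m n} {σ : Fin m → Fin n} (restrict : Vec Bool n → Vec Bool m)
         (lookup-σ : ∀ x i → lookup x (σ i) ≡ lookup (restrict x) i) where

  run-relabel : ∀ T x → run (relabel σ T) x ≡ run T (restrict x)
  run-relabel (leaf b)        x = refl
  run-relabel (query i t₀ t₁) x rewrite lookup-σ x i with lookup (restrict x) i
  ... | true  = run-relabel t₁ x
  ... | false = run-relabel t₀ x

  cost-relabel : ∀ T x → cost (relabel σ T) x ≡ cost T (restrict x)
  cost-relabel (leaf b)        x = refl
  cost-relabel (query i t₀ t₁) x rewrite lookup-σ x i with lookup (restrict x) i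
  ... | true  = cong (_+_ 1ℚ) (cost-relabel t₁ x)
  ... | false = cong (_+_ 1ℚ) (cost-relabel t₀ x)

lookup-↑ˡ : ∀ {A : Set} m {k} (x : Vec A (m ℕ.+ k)) i → lookup x (i ↑ˡ k) ≡ lookup (take m x) i
lookup-↑ˡ m {k} x i = trans (cong (λ y → lookup y (i ↑ˡ k)) (sym (take++drop≡id m x)))
                            (lookup-++ˡ (take m x) (drop m x) i)

lookup-↑ʳ : ∀ {A : Set} m {k} (x : Vec A (m ℕ.+ k)) i → lookup x (m ↑ʳ i) ≡ lookup (drop m x) i
lookup-↑ʳ m x i = trans (cong (λ y → lookup y (m ↑ʳ i)) (sym (take++drop≡id m x)))
                        (lookup-++ʳ (take m x) (drop m x) i)

-- 2 ℕ.^ suc d unfolds to 2 ℕ.^ d ℕ.+ (2 ℕ.^ d ℕ.+ 0), the split used by nandTree.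
module Halves (m : ℕ) where

  left : Vec Bool (m ℕ.+ (m ℕ.+ 0)) → Vec Bool m
  left = take m

  right : Vec Bool (m ℕ.+ (m ℕ.+ 0)) → Vec Bool m
  right x = take m (drop m x)

  leftMarginals : (Fin (m ℕ.+ (m ℕ.+ 0)) → ℚ) → Fin m → ℚ
  leftMarginals p i = p (i ↑ˡ (m ℕ.+ 0))

  rightMarginals : (Fin (m ℕ.+ (m ℕ.+ 0)) → ℚ) → Fin m → ℚ
  rightMarginals p i = p (m ↑ʳ (i ↑ˡ 0))

  lookup-left : ∀ x i → lookup x (i ↑ˡ (m ℕ.+ 0)) ≡ lookup (left x) i
  lookup-left = lookup-↑ˡ m

  lookup-right : ∀ x i → lookup x (m ↑ʳ (i ↑ˡ 0)) ≡ lookup (right x) i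
  lookup-right x i = trans (lookup-↑ʳ m x (i ↑ˡ 0)) (lookup-↑ˡ m (drop m x) i)

  module _ (p : Fin (m ℕ.+ (m ℕ.+ 0)) → ℚ) where

    𝔼-left : (h : Vec Bool m → ℚ) → 𝔼 p (h ∘ left) ≡ 𝔼 (leftMarginals p) h
    𝔼-left = 𝔼-take m p

    𝔼-right : (h : Vec Bool m → ℚ) → 𝔼 p (h ∘ right) ≡ 𝔼 (rightMarginals p) h
    𝔼-right h = trans (𝔼-drop m p (h ∘ take m)) (𝔼-take m (p ∘ (m ↑ʳ_)) h)

    𝔼-left*right : (h k : Vec Bool m → ℚ) →
                   𝔼 p (λ x → h (left x) * k (right x)) ≡ 𝔼 (leftMarginals p) h * 𝔼 (rightMarginals p) k
    𝔼-left*right h k = trans (𝔼-take*drop m p h (k ∘ take m))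
                             (cong (𝔼 (leftMarginals p) h *_) (𝔼-take m (p ∘ (m ↑ʳ_)) k))

nand-comm : ∀ a b → nand a b ≡ nand b a
nand-comm true  true  = refl
nand-comm true  false = refl
nand-comm false true  = refl
nand-comm false false = refl

β : ℚ
β = + 5 / 3

β^-nonNeg : ∀ d → 0ℚ ≤ powℚ β d
β^-nonNeg zero    = decide-≤ 0ℚ 1ℚ
β^-nonNeg (suc d) = *-nonNeg (decide-≤ 0ℚ β) (β^-nonNeg d)

probTrue : ∀ d → (Fin (2 ℕ.^ d) → ℚ) → ℚ
probTrue d p = 𝔼 p (𝟙 ∘ nandTree d)

probTrue-suc : ∀ d p → let open Halves (2 ℕ.^ d) in
               probTrue (suc d) p ≡ 1ℚ - probTrue d (leftMarginals p) * probTrue d (rightMarginals p)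
probTrue-suc d p = begin
  𝔼 p (λ x → 𝟙 (nand (g (left x)) (g (right x))))       ≡⟨ 𝔼-cong p (λ x → 𝟙-nand (g (left x)) (g (right x))) ⟩
  𝔼 p (λ x → 1ℚ - 𝟙 (g (left x)) * 𝟙 (g (right x)))     ≡⟨ 𝔼-const- p 1ℚ _ ⟩
  1ℚ - 𝔼 p (λ x → 𝟙 (g (left x)) * 𝟙 (g (right x)))     ≡⟨ cong (_-_ 1ℚ) (𝔼-left*right p (𝟙 ∘ g) (𝟙 ∘ g)) ⟩
  1ℚ - probTrue d (leftMarginals p) * probTrue d (rightMarginals p) ∎
  where
  open ≡-Reasoning
  open Halves (2 ℕ.^ d)
  g = nandTree d

budget : ∀ d → (Fin (2 ℕ.^ d) → ℚ) → ℚ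
budget d p = (+ 4 / 1 - probTrue d p) * powℚ β d

-- For a ≤ b the worst case is b = a, where the claim reads (1 + β)a² − 3a + 3β − 4 ≥ 0; this
-- holds for all a once β ≥ (1 + √76)/6 ≈ 1.62, and β = 5/3 lies below α ≈ 1.69.
budget-step : ∀ {a b B} → 0ℚ ≤ a → a ≤ b → 0ℚ ≤ B →
              (+ 4 / 1 - a) * B + a * ((+ 4 / 1 - b) * B) ≤ (+ 4 / 1 - (1ℚ - a * b)) * (β * B)
budget-step {a} {b} {B} 0≤a a≤b 0≤B = 0≤q-p⇒p≤q (subst (0ℚ ≤_) (sym difference) difference-nonNeg)
  where
  certificate : ℚ
  certificate = + 8 / 3 * (a * (b - a)) + + 8 / 3 * ((a - + 9 / 16) * (a - + 9 / 16)) + + 5 / 32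
  difference : (+ 4 / 1 - (1ℚ - a * b)) * (β * B) - ((+ 4 / 1 - a) * B + a * ((+ 4 / 1 - b) * B))
             ≡ B * certificate
  difference = solve 3 (λ a b B →
      (con (+ 4 / 1) :- (con 1ℚ :- a :* b)) :* (con β :* B)
        :- ((con (+ 4 / 1) :- a) :* B :+ a :* ((con (+ 4 / 1) :- b) :* B))
    := B :* (con (+ 8 / 3) :* (a :* (b :- a))
             :+ con (+ 8 / 3) :* ((a :- con (+ 9 / 16)) :* (a :- con (+ 9 / 16))) :+ con (+ 5 / 32)))
    refl a b B
  difference-nonNeg : 0ℚ ≤ B * certificate
  difference-nonNeg = *-nonNeg 0≤B (+-mono-≤ (+-mono-≤
    (*-nonNeg (decide-≤ 0ℚ (+ 8 / 3)) (*-nonNeg 0≤a (p≤q⇒0≤q-p a≤b)))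
    (*-nonNeg (decide-≤ 0ℚ (+ 8 / 3)) (square-nonNeg (a - + 9 / 16))))
    (decide-≤ 0ℚ (+ 5 / 32)))

nandᵀ-expectedCost-≤ : ∀ {n} (p : Fin n → ℚ) (T₁ T₂ : DTree n) {a₁ a₂ B : ℚ} →
  0ℚ ≤ a₁ → a₁ ≤ a₂ → 0ℚ ≤ B →
  𝔼 p (cost T₁) ≤ (+ 4 / 1 - a₁) * B → 𝔼 p (cost T₂) ≤ (+ 4 / 1 - a₂) * B →
  𝔼 p (λ x → 𝟙 (run T₁ x) * cost T₂ x) ≡ a₁ * 𝔼 p (cost T₂) →
  𝔼 p (cost (nandᵀ T₁ T₂)) ≤ (+ 4 / 1 - (1ℚ - a₁ * a₂)) * (β * B)
nandᵀ-expectedCost-≤ p T₁ T₂ {a₁} {a₂} {B} 0≤a₁ a₁≤a₂ 0≤B cost₁-≤ cost₂-≤ independent = begin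
  𝔼 p (cost (nandᵀ T₁ T₂))
    ≡⟨ 𝔼-cong p (cost-nandᵀ T₁ T₂) ⟩
  𝔼 p (λ x → cost T₁ x + 𝟙 (run T₁ x) * cost T₂ x)
    ≡⟨ 𝔼-+ p (cost T₁) _ ⟩
  𝔼 p (cost T₁) + 𝔼 p (λ x → 𝟙 (run T₁ x) * cost T₂ x)
    ≡⟨ cong (_+_ (𝔼 p (cost T₁))) independent ⟩
  𝔼 p (cost T₁) + a₁ * 𝔼 p (cost T₂)
    ≤⟨ +-mono-≤ cost₁-≤ (*-monoˡ-≤-nonNeg a₁ {{nonNegative 0≤a₁}} cost₂-≤) ⟩
  (+ 4 / 1 - a₁) * B + a₁ * ((+ 4 / 1 - a₂) * B)
    ≤⟨ budget-step 0≤a₁ a₁≤a₂ 0≤B ⟩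
  (+ 4 / 1 - (1ℚ - a₁ * a₂)) * (β * B)
    ∎
  where open ≤-Reasoning

record Evaluator (d : ℕ) (p : Fin (2 ℕ.^ d) → ℚ) : Set where
  field
    tree           : DTree (2 ℕ.^ d)
    tree-correct   : ∀ x → run tree x ≡ nandTree d x
    expectedCost-≤ : 𝔼 p (cost tree) ≤ budget d p

evaluator-zero : ∀ p → IsProductDist p → Evaluator 0 p
evaluator-zero p p-dist = record
  { tree           = T₀
  ; tree-correct   = λ { (b ∷ []) → run-T₀ b }
  ; expectedCost-≤ = subst (_≤ budget 0 p) (sym 𝔼-cost-T₀) 1≤budget
  }
  where
  T₀ : DTree 1
  T₀ = query zero (leaf false) (leaf true)
  run-T₀ : ∀ b → run T₀ (b ∷ []) ≡ b
  run-T₀ true  = refl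
  run-T₀ false = refl
  cost-T₀ : ∀ b → cost T₀ (b ∷ []) ≡ 1ℚ
  cost-T₀ true  = refl
  cost-T₀ false = refl
  𝔼-cost-T₀ : 𝔼 p (cost T₀) ≡ 1ℚ
  𝔼-cost-T₀ = trans (𝔼-cong p {cost T₀} {λ _ → 1ℚ} (λ { (b ∷ []) → cost-T₀ b })) (𝔼-const p 1ℚ)
  q = probTrue 0 p
  q≤1 : q ≤ 1ℚ
  q≤1 = subst (q ≤_) (𝔼-const p 1ℚ) (𝔼-mono-≤ p-dist (𝟙-≤-1 ∘ nandTree 0))
  slack : budget 0 p - 1ℚ ≡ (1ℚ - q) + + 2 / 1
  slack = solve 1 (λ q → (con (+ 4 / 1) :- q) :* con 1ℚ :- con 1ℚ := (con 1ℚ :- q) :+ con (+ 2 / 1)) refl q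
  1≤budget : 1ℚ ≤ budget 0 p
  1≤budget = 0≤q-p⇒p≤q (subst (0ℚ ≤_) (sym slack) (+-mono-≤ (p≤q⇒0≤q-p q≤1) (decide-≤ 0ℚ (+ 2 / 1))))

module EvaluatorSuc (d : ℕ) (p : Fin (2 ℕ.^ suc d) → ℚ) (p-dist : IsProductDist p) where
  open Halves (2 ℕ.^ d)
  open Evaluator

  M : ℕ
  M = 2 ℕ.^ d

  pˡ pʳ : Fin (2 ℕ.^ d) → ℚ
  pˡ = leftMarginals p
  pʳ = rightMarginals p

  pˡ-dist : IsProductDist pˡ
  pˡ-dist i = p-dist (i ↑ˡ (M ℕ.+ 0))

  pʳ-dist : IsProductDist pʳ
  pʳ-dist i = p-dist (M ↑ʳ (i ↑ˡ 0))

  qˡ qʳ B : ℚ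
  qˡ = probTrue d pˡ
  qʳ = probTrue d pʳ
  B  = powℚ β d

  budget-suc : (+ 4 / 1 - (1ℚ - qˡ * qʳ)) * (β * B) ≡ budget (suc d) p
  budget-suc = cong (λ q → (+ 4 / 1 - q) * (β * B)) (sym (probTrue-suc d p))

  module _ (Eˡ : Evaluator d pˡ) (Eʳ : Evaluator d pʳ) where

    Tˡ Tʳ : DTree (2 ℕ.^ suc d)
    Tˡ = relabel (_↑ˡ (M ℕ.+ 0)) (tree Eˡ)
    Tʳ = relabel (λ i → M ↑ʳ (i ↑ˡ 0)) (tree Eʳ)

    run-Tˡ : ∀ x → run Tˡ x ≡ nandTree d (left x)
    run-Tˡ x = trans (run-relabel left lookup-left (tree Eˡ) x) (tree-correct Eˡ (left x))

    run-Tʳ : ∀ x → run Tʳ x ≡ nandTree d (right x)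
    run-Tʳ x = trans (run-relabel right lookup-right (tree Eʳ) x) (tree-correct Eʳ (right x))

    𝔼-cost-Tˡ : 𝔼 p (cost Tˡ) ≡ 𝔼 pˡ (cost (tree Eˡ))
    𝔼-cost-Tˡ = trans (𝔼-cong p (cost-relabel left lookup-left (tree Eˡ))) (𝔼-left p (cost (tree Eˡ)))

    𝔼-cost-Tʳ : 𝔼 p (cost Tʳ) ≡ 𝔼 pʳ (cost (tree Eʳ))
    𝔼-cost-Tʳ = trans (𝔼-cong p (cost-relabel right lookup-right (tree Eʳ))) (𝔼-right p (cost (tree Eʳ)))

    independentˡʳ : 𝔼 p (λ x → 𝟙 (run Tˡ x) * cost Tʳ x) ≡ qˡ * 𝔼 p (cost Tʳ)
    independentˡʳ = begin
      𝔼 p (λ x → 𝟙 (run Tˡ x) * cost Tʳ x)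
        ≡⟨ 𝔼-cong p (λ x → cong₂ _*_ (cong 𝟙 (run-Tˡ x)) (cost-relabel right lookup-right (tree Eʳ) x)) ⟩
      𝔼 p (λ x → 𝟙 (nandTree d (left x)) * cost (tree Eʳ) (right x))
        ≡⟨ 𝔼-left*right p (𝟙 ∘ nandTree d) (cost (tree Eʳ)) ⟩
      qˡ * 𝔼 pʳ (cost (tree Eʳ))
        ≡⟨ cong (qˡ *_) (sym 𝔼-cost-Tʳ) ⟩
      qˡ * 𝔼 p (cost Tʳ)
        ∎
      where open ≡-Reasoning

    independentʳˡ : 𝔼 p (λ x → 𝟙 (run Tʳ x) * cost Tˡ x) ≡ qʳ * 𝔼 p (cost Tˡ)
    independentʳˡ = begin
      𝔼 p (λ x → 𝟙 (run Tʳ x) * cost Tˡ x)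
        ≡⟨ 𝔼-cong p (λ x → trans (cong₂ _*_ (cong 𝟙 (run-Tʳ x)) (cost-relabel left lookup-left (tree Eˡ) x))
                                 (*-comm (𝟙 (nandTree d (right x))) (cost (tree Eˡ) (left x)))) ⟩
      𝔼 p (λ x → cost (tree Eˡ) (left x) * 𝟙 (nandTree d (right x)))
        ≡⟨ 𝔼-left*right p (cost (tree Eˡ)) (𝟙 ∘ nandTree d) ⟩
      𝔼 pˡ (cost (tree Eˡ)) * qʳ
        ≡⟨ *-comm _ qʳ ⟩
      qʳ * 𝔼 pˡ (cost (tree Eˡ))
        ≡⟨ cong (qʳ *_) (sym 𝔼-cost-Tˡ) ⟩
      qʳ * 𝔼 p (cost Tˡ)
        ∎
      where open ≡-Reasoning

    cost-Tˡ-≤ : 𝔼 p (cost Tˡ) ≤ (+ 4 / 1 - qˡ) * B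
    cost-Tˡ-≤ = subst (_≤ _) (sym 𝔼-cost-Tˡ) (expectedCost-≤ Eˡ)

    cost-Tʳ-≤ : 𝔼 p (cost Tʳ) ≤ (+ 4 / 1 - qʳ) * B
    cost-Tʳ-≤ = subst (_≤ _) (sym 𝔼-cost-Tʳ) (expectedCost-≤ Eʳ)

    evaluatorˡʳ : qˡ ≤ qʳ → Evaluator (suc d) p
    evaluatorˡʳ qˡ≤qʳ = record
      { tree           = nandᵀ Tˡ Tʳ
      ; tree-correct   = λ x → trans (run-nandᵀ Tˡ Tʳ x) (cong₂ nand (run-Tˡ x) (run-Tʳ x))
      ; expectedCost-≤ = subst (𝔼 p (cost (nandᵀ Tˡ Tʳ)) ≤_) budget-suc
          (nandᵀ-expectedCost-≤ p Tˡ Tʳ (𝔼-nonNeg pˡ-dist (𝟙-nonNeg ∘ nandTree d)) qˡ≤qʳ (β^-nonNeg d)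
                                cost-Tˡ-≤ cost-Tʳ-≤ independentˡʳ)
      }

    evaluatorʳˡ : qʳ ≤ qˡ → Evaluator (suc d) p
    evaluatorʳˡ qʳ≤qˡ = record
      { tree           = nandᵀ Tʳ Tˡ
      ; tree-correct   = λ x → trans (run-nandᵀ Tʳ Tˡ x) (trans (cong₂ nand (run-Tʳ x) (run-Tˡ x))
                                                          (nand-comm (nandTree d (right x)) (nandTree d (left x))))
      ; expectedCost-≤ = subst (𝔼 p (cost (nandᵀ Tʳ Tˡ)) ≤_)
          (trans (cong (λ q → (+ 4 / 1 - (1ℚ - q)) * (β * B)) (*-comm qʳ qˡ)) budget-suc)
          (nandᵀ-expectedCost-≤ p Tʳ Tˡ (𝔼-nonNeg pʳ-dist (𝟙-nonNeg ∘ nandTree d)) qʳ≤qˡ (β^-nonNeg d)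
                                cost-Tʳ-≤ cost-Tˡ-≤ independentʳˡ)
      }

    evaluator-suc : Evaluator (suc d) p
    evaluator-suc with qˡ ≤? qʳ
    ... | yes qˡ≤qʳ = evaluatorˡʳ qˡ≤qʳ
    ... | no  qˡ≰qʳ = evaluatorʳˡ (<⇒≤ (≰⇒> qˡ≰qʳ))

evaluator : ∀ d p → IsProductDist p → Evaluator d p
evaluator zero    p p-dist = evaluator-zero p p-dist
evaluator (suc d) p p-dist = evaluator-suc (evaluator d pˡ pˡ-dist) (evaluator d pʳ pʳ-dist)
  where open EvaluatorSuc d p p-dist

truncate : ∀ {n} → ℕ → DTree n → DTree n
truncate k       (leaf b)        = leaf b
truncate zero    (query i t₀ t₁) = leaf false
truncate (suc k) (query i t₀ t₁) = query i (truncate k t₀) (truncate k t₁)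

depth-truncate : ∀ {n} k (T : DTree n) → depth (truncate k T) ℕ.≤ k
depth-truncate k       (leaf b)        = ℕ.z≤n
depth-truncate zero    (query i t₀ t₁) = ℕ.z≤n
depth-truncate (suc k) (query i t₀ t₁) = ℕ.s≤s (ℕₚ.⊔-lub (depth-truncate k t₀) (depth-truncate k t₁))

truncate-≢⇒cost-≥ : ∀ {n} k (T : DTree n) x → run (truncate k T) x ≢ run T x → toℚ (suc k) ≤ cost T x
truncate-≢⇒cost-≥ k       (leaf b)        x ≢ = ⊥-elim (≢ refl)
truncate-≢⇒cost-≥ zero    (query i t₀ t₁) x ≢ with lookup x i
... | true  = subst (_≤ 1ℚ + cost t₁ x) (+-identityʳ 1ℚ) (+-monoʳ-≤ 1ℚ (cost-nonNeg t₁ x))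
... | false = subst (_≤ 1ℚ + cost t₀ x) (+-identityʳ 1ℚ) (+-monoʳ-≤ 1ℚ (cost-nonNeg t₀ x))
truncate-≢⇒cost-≥ (suc k) (query i t₀ t₁) x ≢ with lookup x i
... | true  = subst (_≤ 1ℚ + cost t₁ x) (sym (toℚ-suc (suc k))) (+-monoʳ-≤ 1ℚ (truncate-≢⇒cost-≥ k t₁ x ≢))
... | false = subst (_≤ 1ℚ + cost t₀ x) (sym (toℚ-suc (suc k))) (+-monoʳ-≤ 1ℚ (truncate-≢⇒cost-≥ k t₀ x ≢))

*-𝟙-xor-≤ : ∀ t b c {C} → 0ℚ ≤ C → (b ≢ c → t ≤ C) → t * 𝟙 (b xor c) ≤ C
*-𝟙-xor-≤ t true  true  0≤C _ = subst (_≤ _) (sym (*-zeroʳ t)) 0≤C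
*-𝟙-xor-≤ t true  false 0≤C t≤C = subst (_≤ _) (sym (*-identityʳ t)) (t≤C λ ())
*-𝟙-xor-≤ t false true  0≤C t≤C = subst (_≤ _) (sym (*-identityʳ t)) (t≤C λ ())
*-𝟙-xor-≤ t false false 0≤C _ = subst (_≤ _) (sym (*-zeroʳ t)) 0≤C

markov-truncate : ∀ {n} {p : Fin n → ℚ} → IsProductDist p → (T : DTree n) {f : Vec Bool n → Bool} →
                  (∀ x → run T x ≡ f x) → ∀ k → toℚ (suc k) * errorProb p (truncate k T) f ≤ 𝔼 p (cost T)
markov-truncate {p = p} p-dist T {f} T-correct k = begin
  t * errorProb p T′ f                          ≡⟨ cong (t *_) (errorProb≡𝔼 p T′ f) ⟩
  t * 𝔼 p (λ x → 𝟙 (run T′ x xor f x))          ≡⟨ sym (𝔼-*ˡ p t _) ⟩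
  𝔼 p (λ x → t * 𝟙 (run T′ x xor f x))          ≤⟨ 𝔼-mono-≤ p-dist pointwise ⟩
  𝔼 p (cost T)                                  ∎
  where
  open ≤-Reasoning
  t  = toℚ (suc k)
  T′ = truncate k T
  pointwise : ∀ x → t * 𝟙 (run T′ x xor f x) ≤ cost T x
  pointwise x = *-𝟙-xor-≤ t (run T′ x) (f x) (cost-nonNeg T x)
    (λ ≢ → truncate-≢⇒cost-≥ k T x (λ eq → ≢ (trans eq (T-correct x))))

zeroError⇒DprodAtMost : ∀ {n} (f : Vec Bool n → Bool) (r : ℚ) →
  ((p : Fin n → ℚ) → IsProductDist p →
     Σ (DTree n) λ T → (∀ x → run T x ≡ f x) × (+ 3 / 1 * 𝔼 p (cost T) ≤ r)) →
  DprodAtMost f r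
zeroError⇒DprodAtMost f r evaluate p p-dist with evaluate p p-dist
... | T , T-correct , 3𝔼≤r
  with ℕ-floor r (≤-trans (*-nonNeg (decide-≤ 0ℚ (+ 3 / 1)) (𝔼-nonNeg p-dist (cost-nonNeg T))) 3𝔼≤r)
... | k , k≤r , r≤k+1 = truncate k T , ≤-trans (toℚ-mono-≤ (depth-truncate k T)) k≤r , error-≤
  where
  t = toℚ (suc k)
  0<t : 0ℚ < t
  0<t = <-≤-trans (decide-< 0ℚ 1ℚ) (toℚ-mono-≤ {1} {suc k} (ℕ.s≤s ℕ.z≤n))
  error-≤ : errorProb p (truncate k T) f ≤ + 1 / 3
  error-≤ = *-cancelˡ-≤-pos t {{positive 0<t}} (begin
    t * errorProb p (truncate k T) f   ≤⟨ markov-truncate p-dist T T-correct k ⟩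
    𝔼 p (cost T)                       ≡⟨ solve 1 (λ e → e := con (+ 1 / 3) :* (con (+ 3 / 1) :* e)) refl _ ⟩
    + 1 / 3 * (+ 3 / 1 * 𝔼 p (cost T)) ≤⟨ *-monoˡ-≤-nonNeg (+ 1 / 3) 3𝔼≤r ⟩
    + 1 / 3 * r                        ≤⟨ *-monoˡ-≤-nonNeg (+ 1 / 3) r≤k+1 ⟩
    + 1 / 3 * t                        ≡⟨ *-comm (+ 1 / 3) t ⟩
    t * (+ 1 / 3)                      ∎)
    where open ≤-Reasoning

nandTree-DprodAtMost : ∀ d → DprodAtMost (nandTree d) (+ 12 / 1 * powℚ β d)
nandTree-DprodAtMost d = zeroError⇒DprodAtMost (nandTree d) _ λ p p-dist →
  let open Evaluator (evaluator d p p-dist) in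
  tree , tree-correct , ≤-trans (*-monoˡ-≤-nonNeg (+ 3 / 1) expectedCost-≤)
                                (three-budget-≤ (𝔼-nonNeg p-dist (𝟙-nonNeg ∘ nandTree d)))
  where
  three-budget-≤ : ∀ {q} → 0ℚ ≤ q → + 3 / 1 * ((+ 4 / 1 - q) * powℚ β d) ≤ + 12 / 1 * powℚ β d
  three-budget-≤ {q} 0≤q = 0≤q-p⇒p≤q (subst (0ℚ ≤_) (sym slack)
    (*-nonNeg (*-nonNeg (decide-≤ 0ℚ (+ 3 / 1)) 0≤q) (β^-nonNeg d)))
    where
    slack : + 12 / 1 * powℚ β d - + 3 / 1 * ((+ 4 / 1 - q) * powℚ β d) ≡ (+ 3 / 1 * q) * powℚ β d
    slack = solve 2 (λ q B → con (+ 12 / 1) :* B :- con (+ 3 / 1) :* ((con (+ 4 / 1) :- q) :* B)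
                             := (con (+ 3 / 1) :* q) :* B) refl q (powℚ β d)

lemma2 : Σ ℚ λ β → LtAlpha β × Σ ℚ λ C → (0ℚ < C) × Σ ℕ λ d₀ →
           (d : ℕ) → d ≥ d₀ → DprodAtMost (nandTree d) (C * powℚ β d)
lemma2 = β , inj₂ (decide-< _ _) , + 12 / 1 , decide-< 0ℚ (+ 12 / 1) , 0 , λ d _ → nandTree-DprodAtMost d
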